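{- Let $A,B$ be integers, $D=B^2-4A$, and let $\{u_n\}_{n\ge0}$, $\{v_n\}_{n\ge0}$ be the Lucas sequences $u_0=0$, $u_1=1$, $u_{n+1}=Bu_n-Au_{n-1}$ and $v_0=2$, $v_1=B$, $v_{n+1}=Bv_n-Av_{n-1}$ ($n\ge1$). Let $p$ be an odd prime with $p\nmid DA$ and $\varepsilon=\left(\frac{D}{p}\right)$ (Legendre symbol). Then: (1) if $\varepsilon=1$, then $\frac{v_{p-1}-2}{p}\equiv q_p(A)\pmod p$; (2) if $\varepsilon=-1$, then $\frac{v_{p+1}-2A}{p}\equiv Aq_p(A)\pmod p$.
   Context: For an odd prime $p$ and an integer $x$ with $p\nmid x$, $q_p(x)=\frac{x^{p-1}-1}{p}$ is the Fermat quotient. -}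

module Defs where

open import Data.Nat as ℕ using (ℕ; zero; suc)
open import Data.Integer using (ℤ; +_; _+_; _-_; _*_; _^_; -_; 1ℤ; 0ℤ)
open import Data.Integer.DivMod using (_/ℕ_)
open import Data.Integer.Divisibility using (_∣_)
open import Data.Product using (∃; _×_)
open import Relation.Nullary using (¬_)

lucasU : ℤ → ℤ → ℕ → ℤ
lucasU A B zero = + 0
lucasU A B (suc zero) = + 1
lucasU A B (suc (suc n)) = B * lucasU A B (suc n) - A * lucasU A B n

lucasV : ℤ → ℤ → ℕ → ℤ
lucasV A B zero = + 2
lucasV A B (suc zero) = B
lucasV A B (suc (suc n)) = B * lucasV A B (suc n) - A * lucasV A B n

_≡_[mod_] : ℤ → ℤ → ℕ → Set
a ≡ b [mod m ] = (+ m) ∣ (a - b)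

QuadRes : ℕ → ℤ → Set
QuadRes p d = ∃ λ (x : ℤ) → (x * x) ≡ d [mod p ]

-- Legendre symbol (d/p) for an odd prime p, as predicates:
-- (d/p) = 1  iff  p ∤ d and d is a quadratic residue mod p
LegendreOne : ℤ → ℕ → Set
LegendreOne d p = ¬ ((+ p) ∣ d) × QuadRes p d

-- (d/p) = -1  iff  d is a quadratic non-residue mod p (p ∤ d automatically)
LegendreMinusOne : ℤ → ℕ → Set
LegendreMinusOne d p = ¬ QuadRes p d

-- Fermat quotient q_p(x) = (x^(p-1) - 1)/p  (exact division when p ∤ x, p prime)
fermatQuotient : (p : ℕ) → .{{_ : ℕ.NonZero p}} → ℤ → ℤ
fermatQuotient p x = ((x ^ (p ℕ.∸ 1)) - + 1) /ℕ p

{-# OPTIONS --safe #-}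
module Submission where

-- Write α = B + √D.  Then 2 α^n = 2^n (v_n + u_n √D), and modulo p the freshman's dream together
-- with Fermat's little theorem gives α^p ≡ B + D^((p-1)/2) √D, while Euler's criterion (proved by
-- pairing each residue z with D/z, and with 1/z for Wilson's theorem) gives D^((p-1)/2) ≡ ε.
-- Hence v_p ≡ B and u_p ≡ ε, and running the recurrence one step back (ε = 1) or forward
-- (ε = -1) gives v_{p-ε} ≡ 2a and u_{p-ε} ≡ 0 with a = 1, resp. a = A.  Writing v_{p-ε} = 2a + pX,
-- u_{p-ε} = pt and A^(p-1) = 1 + p q_p(A), the norm identity v_n² - D u_n² = 4Aⁿ becomes
-- p·4a(X - a q_p(A)) = p²(Dt² - X²), so X ≡ a q_p(A) (mod p).

open import Algebra.Bundles using (CommutativeMonoid; CommutativeRing; CommutativeSemiring; Semiring)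
open import Algebra.Structures using (IsCommutativeMonoid; IsCommutativeRing)
open import Algebra.Structures.Biased using (isCommutativeMonoidˡ; isCommutativeSemiringˡ)
open import Data.Bool as Bool using (Bool; true; false; _∧_; if_then_else_)
open import Data.Bool.Properties using (¬-not; T-≡; T-∧)
open import Data.Empty using (⊥-elim)
open import Data.Fin as Fin using (fromℕ; inject₁; toℕ)
open import Data.Fin.Properties using (toℕ-fromℕ; toℕ-inject₁; toℕ<n)
open import Data.Integer as ℤ using (ℤ; +_)
import Data.Integer.Properties as ℤ
open import Data.Integer.DivMod using (_/ℕ_; _%ℕ_)
import Data.Integer.DivMod as ℤ
open import Data.Integer.Divisibility using (_∣_)
import Data.Integer.Divisibility.Signed as Signed
open import Data.Integer.Tactic.RingSolver using (solve-∀)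
open import Data.Nat as ℕ using (ℕ; zero; suc; _∸_; _!)
import Data.Nat.Divisibility as ℕ
import Data.Nat.Properties as ℕ
open import Data.Nat.Combinatorics using (_C_; nCn≡1; nCk≡n!/k![n-k]!; k![n∸k]!∣n!)
open import Data.Nat.DivMod using (m/n*n≡m)
open import Data.Nat.Primality
  using (Prime; euclidsLemma; prime⇒irreducible; prime⇒nonTrivial; prime⇒nonZero)
open import Data.Product using (_×_; _,_; proj₁; proj₂; ∃)
open import Data.Product.Relation.Binary.Pointwise.NonDependent using (Pointwise; ×-isEquivalence)
open import Data.Sum using (_⊎_; inj₁; inj₂)
open import Data.Vec.Functional using (Vector; init; replicate; tail)
open import Defs
open import Function using (_∘_; id)
open import Function.Bundles using (Equivalence)
open import Level using (0ℓ)
open import Relation.Binary.PropositionalEquality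
  using (_≡_; _≢_; refl; sym; trans; cong; cong₂; subst; subst₂; module ≡-Reasoning)
import Relation.Binary.Reasoning.Setoid
open import Relation.Binary.Structures using (IsEquivalence)
open import Relation.Nullary using (¬_; yes; no; contradiction)

∣∧<⇒≡0 : ∀ {m n} → m ℕ.∣ n → n ℕ.< m → n ≡ 0
∣∧<⇒≡0 {n = zero}  _   _   = refl
∣∧<⇒≡0 {n = suc _} m∣n n<m = ⊥-elim (ℕ.>⇒∤ n<m m∣n)

even-or-odd : ∀ n → (∃ λ k → n ≡ k ℕ.+ k) ⊎ (∃ λ k → n ≡ suc (k ℕ.+ k))
even-or-odd zero    = inj₁ (0 , refl)
even-or-odd (suc n) with even-or-odd n
... | inj₁ (k , n≡2k)   = inj₂ (k , cong suc n≡2k)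
... | inj₂ (k , n≡1+2k) = inj₁ (suc k , cong suc (trans n≡1+2k (sym (ℕ.+-suc k k))))

odd-prime : ∀ {p} → Prime p → p ≢ 2 → ∃ λ M → p ≡ suc (M ℕ.+ M)
odd-prime {p} p-prime p≢2 with even-or-odd p
... | inj₂ odd = odd
... | inj₁ (k , p≡2k) with prime⇒irreducible p-prime (ℕ.divides k (trans p≡2k 2k≡k*2))
  where
  2k≡k*2 : k ℕ.+ k ≡ k ℕ.* 2
  2k≡k*2 = trans (cong (k ℕ.+_) (sym (ℕ.+-identityʳ k))) (ℕ.*-comm 2 k)
...   | inj₁ ()
...   | inj₂ 2≡p = ⊥-elim (p≢2 (sym 2≡p))

module _ {p : ℕ} (p-prime : Prime p) where

  private instance
    _ = prime⇒nonZero p-prime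
    _ = prime⇒nonTrivial p-prime

  prime∤m! : ∀ {m} → m ℕ.< p → ¬ p ℕ.∣ m !
  prime∤m! {zero}  _   p∣1  = ℕ.nonTrivial⇒≢1 (ℕ.∣1⇒≡1 p∣1)
  prime∤m! {suc m} m<p p∣m! with euclidsLemma (suc m) (m !) p-prime p∣m!
  ... | inj₁ p∣1+m = ℕ.>⇒∤ m<p p∣1+m
  ... | inj₂ p∣m!  = prime∤m! (ℕ.<-trans (ℕ.n<1+n m) m<p) p∣m!

  prime∣pCk : ∀ {k} → 0 ℕ.< k → k ℕ.< p → p ℕ.∣ p C k
  prime∣pCk {k} 0<k k<p with euclidsLemma (p C k) (k ! ℕ.* (p ∸ k) !) p-prime p∣pCk*k![p-k]!
    where
    instance _ = k ℕ.!* (p ∸ k) !≢0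
    n∣n! : ∀ n → .{{ℕ.NonZero n}} → n ℕ.∣ n !
    n∣n! (suc n) = ℕ.m∣m*n (n !)
    p∣pCk*k![p-k]! : p ℕ.∣ (p C k) ℕ.* (k ! ℕ.* (p ∸ k) !)
    p∣pCk*k![p-k]! = subst (p ℕ.∣_) (sym (trans
      (cong (ℕ._* (k ! ℕ.* (p ∸ k) !)) (nCk≡n!/k![n-k]! (ℕ.<⇒≤ k<p)))
      (m/n*n≡m (k![n∸k]!∣n! (ℕ.<⇒≤ k<p))))) (n∣n! p)
  ... | inj₁ p∣pCk = p∣pCk
  ... | inj₂ p∣k![p-k]! with euclidsLemma (k !) ((p ∸ k) !) p-prime p∣k![p-k]!
  ...   | inj₁ p∣k!     = ⊥-elim (prime∤m! k<p p∣k!)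
  ...   | inj₂ p∣[p-k]! = ⊥-elim (prime∤m! (ℕ.∸-monoʳ-< 0<k (ℕ.<⇒≤ k<p)) p∣[p-k]!)

-- The freshman's dream

module _ {c ℓ} (R : Semiring c ℓ) where

  open Semiring R hiding (zero; refl; sym; trans; reflexive)
  open import Algebra.Properties.Semiring.Exp R using (_^_)
  open import Algebra.Properties.Semiring.Mult R
    renaming (_×_ to _·_) using (×-congʳ; ×-assocˡ; ×-assoc-*; ×-homo-1)
  open import Algebra.Properties.Semiring.Sum R
    using (sum; sum-cong-≋; sum-init-last; sum-replicate-zero)
  open import Relation.Binary.Reasoning.Setoid setoid

  sum-ends : ∀ {n} (t : Vector Carrier (suc (suc n))) →
             (∀ i → 0 ℕ.< toℕ i → toℕ i ℕ.< suc n → t i ≈ 0#) →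
             sum t ≈ t Fin.zero + t (fromℕ (suc n))
  sum-ends {n} t inner≈0 = +-congˡ (begin
    sum (tail t)                              ≈⟨ sum-init-last (tail t) ⟩
    sum (init (tail t)) + t (fromℕ (suc n))   ≈⟨ +-congʳ (sum-cong-≋ init-tail≈0) ⟩
    sum (replicate n 0#) + t (fromℕ (suc n))  ≈⟨ +-congʳ (sum-replicate-zero n) ⟩
    0# + t (fromℕ (suc n))                    ≈⟨ +-identityˡ _ ⟩
    t (fromℕ (suc n))                         ∎)
    where
    init-tail≈0 : ∀ i → t (Fin.suc (inject₁ i)) ≈ 0#
    init-tail≈0 i = inner≈0 (Fin.suc (inject₁ i)) ℕ.z<s
      (ℕ.s<s (subst (ℕ._< n) (sym (toℕ-inject₁ i)) (toℕ<n i)))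

  p·1≈0⇒p·x≈0 : ∀ {p} → p · 1# ≈ 0# → ∀ x → p · x ≈ 0#
  p·1≈0⇒p·x≈0 {p} p·1≈0 x = begin
    p · x          ≈⟨ ×-congʳ p (*-identityˡ x) ⟨
    p · (1# * x)   ≈⟨ ×-assoc-* p 1# x ⟨
    (p · 1#) * x   ≈⟨ *-congʳ p·1≈0 ⟩
    0# * x         ≈⟨ zeroˡ x ⟩
    0#             ∎

  freshman's-dream : ∀ {p} → Prime p → p · 1# ≈ 0# →
                     ∀ {x y} → x * y ≈ y * x → (x + y) ^ p ≈ x ^ p + y ^ p
  freshman's-dream {p@(suc (suc _))} p-prime p·1≈0 {x} {y} xy≈yx = begin
    (x + y) ^ p                                         ≈⟨ theorem xy≈yx p ⟩
    binomialExpansion p                                 ≈⟨ sum-ends (binomialTerm p) inner≈0 ⟩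
    binomialTerm p Fin.zero + binomialTerm p (fromℕ p)  ≈⟨ +-comm _ _ ⟩
    binomialTerm p (fromℕ p) + binomialTerm p Fin.zero  ≈⟨ +-cong last≈xᵖ first≈yᵖ ⟩
    x ^ p + y ^ p                                       ∎
    where
    open import Algebra.Properties.Semiring.Binomial R x y
      using (theorem; binomialExpansion; binomialTerm; binomial)
    inner≈0 : ∀ i → 0 ℕ.< toℕ i → toℕ i ℕ.< p → binomialTerm p i ≈ 0#
    inner≈0 i 0<i i<p = begin
      (p C toℕ i) · binomial p i   ≡⟨ cong (_· binomial p i) (ℕ.m∣n⇒n≡m*quotient p∣pCi) ⟩
      (p ℕ.* q) · binomial p i     ≈⟨ ×-assocˡ (binomial p i) p q ⟨
      p · (q · binomial p i)       ≈⟨ p·1≈0⇒p·x≈0 {p} p·1≈0 (q · binomial p i) ⟩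
      0#                           ∎
      where
      p∣pCi = prime∣pCk p-prime 0<i i<p
      q = ℕ.quotient p∣pCi
    first≈yᵖ : binomialTerm p Fin.zero ≈ y ^ p
    first≈yᵖ = begin
      1 · (1# * y ^ p)  ≈⟨ ×-homo-1 _ ⟩
      1# * y ^ p        ≈⟨ *-identityˡ _ ⟩
      y ^ p             ∎
    last≈xᵖ : binomialTerm p (fromℕ p) ≈ x ^ p
    last≈xᵖ = begin
      binomialTerm p (fromℕ p)         ≡⟨ cong (λ k → (p C k) · (x ^ k * y ^ (p ∸ k))) (toℕ-fromℕ p) ⟩
      (p C p) · (x ^ p * y ^ (p ∸ p))  ≡⟨ cong₂ (λ c e → c · (x ^ p * y ^ e)) (nCn≡1 p) (ℕ.n∸n≡0 p) ⟩
      1 · (x ^ p * 1#)                 ≈⟨ ×-homo-1 _ ⟩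
      x ^ p * 1#                       ≈⟨ *-identityʳ _ ⟩
      x ^ p                            ∎

infixl 6 _∖_
_∖_ : (ℕ → Bool) → ℕ → ℕ → Bool
(S ∖ z) w with w ℕ.≟ z
... | yes _ = false
... | no  _ = S w

∖-self : ∀ S z → (S ∖ z) z ≡ false
∖-self S z with z ℕ.≟ z
... | yes _   = refl
... | no  z≢z = contradiction refl z≢z

∖-other : ∀ S {z w} → w ≢ z → (S ∖ z) w ≡ S w
∖-other S {z} {w} w≢z with w ℕ.≟ z
... | yes w≡z = contradiction w≡z w≢z
... | no  _   = refl

∖-member : ∀ S z w → (S ∖ z) w ≡ true → S w ≡ true × w ≢ z
∖-member S z w S∖z∋w with w ℕ.≟ z
∖-member S z w () | yes _
... | no w≢z = S∖z∋w , w≢z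

member-or-empty : ∀ (S : ℕ → Bool) n →
                  (∃ λ z → z ℕ.< n × S z ≡ true) ⊎ (∀ {w} → w ℕ.< n → S w ≡ false)
member-or-empty S n with ℕ.anyUpTo? (λ w → S w Bool.≟ true) n
... | yes member = inj₁ member
... | no  empty  = inj₂ (λ {w} w<n → ¬-not {S w} {true} (λ S∋w → empty (w , w<n , S∋w)))

module SubsetSum {c ℓ} (M : CommutativeMonoid c ℓ) where

  open CommutativeMonoid M using (Carrier; _≈_; _∙_; ε; ∙-congˡ; setoid; isEquivalence)
  open import Algebra.Properties.CommutativeSemigroup (CommutativeMonoid.commutativeSemigroup M)
    using (x∙yz≈y∙xz)
  open import Relation.Binary.Reasoning.Setoid setoid

  ∑ : (ℕ → Bool) → (ℕ → Carrier) → ℕ → Carrier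
  ∑ S f zero    = ε
  ∑ S f (suc n) = if S n then f n ∙ ∑ S f n else ∑ S f n

  ∑-cong : ∀ {S T} f n → (∀ {w} → w ℕ.< n → S w ≡ T w) → ∑ S f n ≈ ∑ T f n
  ∑-cong f zero    _   = IsEquivalence.refl isEquivalence
  ∑-cong {S} {T} f (suc n) S≗T rewrite S≗T (ℕ.n<1+n n) with T n
  ... | true  = ∙-congˡ (∑-cong f n (S≗T ∘ ℕ.m<n⇒m<1+n))
  ... | false = ∑-cong f n (S≗T ∘ ℕ.m<n⇒m<1+n)

  ∑-empty : ∀ {S} f n → (∀ {w} → w ℕ.< n → S w ≡ false) → ∑ S f n ≈ ε
  ∑-empty f zero    _   = IsEquivalence.refl isEquivalence
  ∑-empty {S} f (suc n) S∌ rewrite S∌ (ℕ.n<1+n n) = ∑-empty f n (S∌ ∘ ℕ.m<n⇒m<1+n)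

  ∑-remove : ∀ {S z} f n → z ℕ.< n → S z ≡ true → ∑ S f n ≈ f z ∙ ∑ (S ∖ z) f n
  ∑-remove {S} {z} f (suc n) z<1+n S∋z with z ℕ.≟ n
  ... | yes refl rewrite S∋z | ∖-self S z = ∙-congˡ (∑-cong f n (λ w<z → sym (∖-other S (ℕ.<⇒≢ w<z))))
  ... | no z≢n rewrite ∖-other S (z≢n ∘ sym) with S n
  ...   | true  = begin
    f n ∙ ∑ S f n                ≈⟨ ∙-congˡ (∑-remove f n z<n S∋z) ⟩
    f n ∙ (f z ∙ ∑ (S ∖ z) f n)  ≈⟨ x∙yz≈y∙xz (f n) (f z) _ ⟩
    f z ∙ (f n ∙ ∑ (S ∖ z) f n)  ∎
    where z<n = ℕ.≤∧≢⇒< (ℕ.≤-pred z<1+n) z≢n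
  ...   | false = ∑-remove f n (ℕ.≤∧≢⇒< (ℕ.≤-pred z<1+n) z≢n) S∋z

open import Data.Integer using (_+_; _-_; _*_; _^_; -_; 0ℤ; 1ℤ; -1ℤ)

-- A record rather than a synonym for _≡_[mod_], so that Agda can infer a and b.
infix 4 _≈_[mod_]
record _≈_[mod_] (a b : ℤ) (n : ℕ) : Set where
  constructor mod
  field divides : + n Signed.∣ a - b

module _ {n : ℕ} where

  mod-reflexive : ∀ {a b} → a ≡ b → a ≈ b [mod n ]
  mod-reflexive {a} refl = mod (Signed.divides 0ℤ (ℤ.+-inverseʳ a))

  mod-refl : ∀ {a} → a ≈ a [mod n ]
  mod-refl = mod-reflexive refl

  mod-sym : ∀ {a b} → a ≈ b [mod n ] → b ≈ a [mod n ]
  mod-sym {a} {b} (mod d) = mod (subst (+ n Signed.∣_) (swap a b) (Signed.∣m⇒∣-m d))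
    where
    swap : ∀ a b → - (a - b) ≡ b - a
    swap = solve-∀

  mod-trans : ∀ {a b c} → a ≈ b [mod n ] → b ≈ c [mod n ] → a ≈ c [mod n ]
  mod-trans {a} {b} {c} (mod d) (mod e) =
    mod (subst (+ n Signed.∣_) (chain a b c) (Signed.∣m∣n⇒∣m+n d e))
    where
    chain : ∀ a b c → (a - b) + (b - c) ≡ a - c
    chain = solve-∀

  +-cong-mod : ∀ {a b c d} → a ≈ b [mod n ] → c ≈ d [mod n ] → a + c ≈ b + d [mod n ]
  +-cong-mod {a} {b} {c} {d} (mod e) (mod f) =
    mod (subst (+ n Signed.∣_) (split a b c d) (Signed.∣m∣n⇒∣m+n e f))
    where
    split : ∀ a b c d → (a - b) + (c - d) ≡ (a + c) - (b + d)
    split = solve-∀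

  neg-cong-mod : ∀ {a b} → a ≈ b [mod n ] → - a ≈ - b [mod n ]
  neg-cong-mod {a} {b} (mod e) = mod (subst (+ n Signed.∣_) (flip a b) (Signed.∣m⇒∣-m e))
    where
    flip : ∀ a b → - (a - b) ≡ - a - - b
    flip = solve-∀

  *-cong-mod : ∀ {a b c d} → a ≈ b [mod n ] → c ≈ d [mod n ] → a * c ≈ b * d [mod n ]
  *-cong-mod {a} {b} {c} {d} (mod e) (mod f) = mod (subst (+ n Signed.∣_) (split a b c d)
    (Signed.∣m∣n⇒∣m+n (Signed.∣n⇒∣m*n c e) (Signed.∣n⇒∣m*n b f)))
    where
    split : ∀ a b c d → c * (a - b) + b * (c - d) ≡ a * c - b * d
    split = solve-∀

  *-congˡ-mod : ∀ c {a b} → a ≈ b [mod n ] → c * a ≈ c * b [mod n ]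
  *-congˡ-mod c = *-cong-mod (mod-refl {c})

  *-congʳ-mod : ∀ c {a b} → a ≈ b [mod n ] → a * c ≈ b * c [mod n ]
  *-congʳ-mod c a≈b = *-cong-mod a≈b (mod-refl {c})

  minus-cong-mod : ∀ {a b c d} → a ≈ b [mod n ] → c ≈ d [mod n ] → a - c ≈ b - d [mod n ]
  minus-cong-mod a≈b c≈d = +-cong-mod a≈b (neg-cong-mod c≈d)

  ^-cong-mod : ∀ {a b} k → a ≈ b [mod n ] → a ^ k ≈ b ^ k [mod n ]
  ^-cong-mod zero    a≈b = mod-refl
  ^-cong-mod (suc k) a≈b = *-cong-mod a≈b (^-cong-mod k a≈b)

  mod-isEquivalence : IsEquivalence (_≈_[mod n ])
  mod-isEquivalence = record { refl = mod-refl ; sym = mod-sym ; trans = mod-trans }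

  ∣⇒≈0 : ∀ a → (+ n) ∣ a → a ≈ 0ℤ [mod n ]
  ∣⇒≈0 a n∣a = mod (subst (+ n Signed.∣_) (sym (ℤ.+-identityʳ a)) (Signed.∣ᵤ⇒∣ n∣a))

  ≈0⇒∣ : ∀ {a} → a ≈ 0ℤ [mod n ] → (+ n) ∣ a
  ≈0⇒∣ {a} (mod e) = Signed.∣⇒∣ᵤ (subst (+ n Signed.∣_) (ℤ.+-identityʳ a) e)

  ∤-*⇒∤ : ∀ a b → ¬ (+ n) ∣ a * b → ¬ (+ n) ∣ a × ¬ (+ n) ∣ b
  ∤-*⇒∤ a b n∤ab =
    (λ n∣a → n∤ab (Signed.∣⇒∣ᵤ (Signed.∣m⇒∣m*n b (Signed.∣ᵤ⇒∣ {+ n} {a} n∣a)))) ,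
    (λ n∣b → n∤ab (Signed.∣⇒∣ᵤ (Signed.∣n⇒∣m*n a (Signed.∣ᵤ⇒∣ {+ n} {b} n∣b))))

  ≈⇒≡[mod] : ∀ {a b} → a ≈ b [mod n ] → a ≡ b [mod n ]
  ≈⇒≡[mod] (mod e) = Signed.∣⇒∣ᵤ e

  modulus≈0 : + n ≈ 0ℤ [mod n ]
  modulus≈0 = ∣⇒≈0 (+ n) ℕ.∣-refl

  a≈a%ℕn : ∀ a → .{{_ : ℕ.NonZero n}} → a ≈ + (a %ℕ n) [mod n ]
  a≈a%ℕn a = mod (Signed.divides (a /ℕ n) (subtract (ℤ.a≡a%ℕn+[a/ℕn]*n a n)))
    where
    subtract : ∀ {a r y} → a ≡ r + y → a - r ≡ y
    subtract {r = r} {y} refl = cancel r y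
      where
      cancel : ∀ r y → r + y - r ≡ y
      cancel = solve-∀

  ≈⇒-≈0 : ∀ {a b} → a ≈ b [mod n ] → a - b ≈ 0ℤ [mod n ]
  ≈⇒-≈0 {a} {b} (mod e) = mod (subst (+ n Signed.∣_) (sym (ℤ.+-identityʳ (a - b))) e)

  /ℕ-exact : ∀ {a} .{{_ : ℕ.NonZero n}} → a ≈ 0ℤ [mod n ] → a ≡ (a /ℕ n) * + n
  /ℕ-exact {a} a≈0 = begin
    a                              ≡⟨ ℤ.a≡a%ℕn+[a/ℕn]*n a n ⟩
    + (a %ℕ n) + (a /ℕ n) * + n    ≡⟨ cong (λ r → + r + (a /ℕ n) * + n) a%n≡0 ⟩
    + 0 + (a /ℕ n) * + n           ≡⟨ ℤ.+-identityˡ _ ⟩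
    (a /ℕ n) * + n                 ∎
    where
    open ≡-Reasoning
    a%n≡0 : a %ℕ n ≡ 0
    a%n≡0 = ∣∧<⇒≡0 (≈0⇒∣ (mod-trans (mod-sym (a≈a%ℕn a)) a≈0)) (ℤ.n%ℕd<d a n)

  ≡[mod]⇒≈ : ∀ {a b} → a ≡ b [mod n ] → a ≈ b [mod n ]
  ≡[mod]⇒≈ n∣a-b = mod (Signed.∣ᵤ⇒∣ n∣a-b)

ℤmod : ℕ → CommutativeRing 0ℓ 0ℓ
ℤmod n = record { isCommutativeRing = isCommutativeRing }
  where
  ≡⇒mod = mod-reflexive {n}
  isCommutativeRing : IsCommutativeRing (_≈_[mod n ]) _+_ _*_ -_ 0ℤ 1ℤ
  isCommutativeRing = record
    { isRing = record
      { +-isAbelianGroup = record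
        { isGroup = record
          { isMonoid = record
            { isSemigroup = record
              { isMagma = record { isEquivalence = mod-isEquivalence ; ∙-cong = +-cong-mod }
              ; assoc = λ a b c → ≡⇒mod (ℤ.+-assoc a b c) }
            ; identity = (λ a → ≡⇒mod (ℤ.+-identityˡ a)) , (λ a → ≡⇒mod (ℤ.+-identityʳ a)) }
          ; inverse = (λ a → ≡⇒mod (ℤ.+-inverseˡ a)) , (λ a → ≡⇒mod (ℤ.+-inverseʳ a))
          ; ⁻¹-cong = neg-cong-mod }
        ; comm = λ a b → ≡⇒mod (ℤ.+-comm a b) }
      ; *-cong = *-cong-mod
      ; *-assoc = λ a b c → ≡⇒mod (ℤ.*-assoc a b c)
      ; *-identity = (λ a → ≡⇒mod (ℤ.*-identityˡ a)) , (λ a → ≡⇒mod (ℤ.*-identityʳ a))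
      ; distrib = (λ a b c → ≡⇒mod (ℤ.*-distribˡ-+ a b c)) , (λ a b c → ≡⇒mod (ℤ.*-distribʳ-+ a b c)) }
    ; *-comm = λ a b → ≡⇒mod (ℤ.*-comm a b) }

module ModReasoning (n : ℕ) = Relation.Binary.Reasoning.Setoid (CommutativeRing.setoid (ℤmod n))

module _ {p : ℕ} (p-prime : Prime p) where

  prime-∣-* : ∀ a b → (+ p) ∣ a * b → (+ p) ∣ a ⊎ (+ p) ∣ b
  prime-∣-* a b p∣ab = euclidsLemma ℤ.∣ a ∣ ℤ.∣ b ∣ p-prime (subst (p ℕ.∣_) (ℤ.abs-* a b) p∣ab)

  prime-∤-* : ∀ a b → ¬ (+ p) ∣ a → ¬ (+ p) ∣ b → ¬ (+ p) ∣ a * b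
  prime-∤-* a b p∤a p∤b p∣ab with prime-∣-* a b p∣ab
  ... | inj₁ p∣a = p∤a p∣a
  ... | inj₂ p∣b = p∤b p∣b

  prime-∣-*-∤ : ∀ a b → ¬ (+ p) ∣ a → (+ p) ∣ a * b → (+ p) ∣ b
  prime-∣-*-∤ a b p∤a p∣ab with prime-∣-* a b p∣ab
  ... | inj₁ p∣a = ⊥-elim (p∤a p∣a)
  ... | inj₂ p∣b = p∣b

  prime-∤1 : ¬ (+ p) ∣ 1ℤ
  prime-∤1 = ℕ.nonTrivial⇒≢1 {{prime⇒nonTrivial p-prime}} ∘ ℕ.∣1⇒≡1

  *-cancelˡ-mod : ∀ c {a b} → ¬ (+ p) ∣ c → c * a ≈ c * b [mod p ] → a ≈ b [mod p ]
  *-cancelˡ-mod c {a} {b} p∤c (mod p∣ca-cb) =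
    mod (Signed.∣ᵤ⇒∣ (prime-∣-*-∤ c (a - b) p∤c (Signed.∣⇒∣ᵤ (subst (+ p Signed.∣_) (factor c a b) p∣ca-cb))))
    where
    factor : ∀ c a b → c * a - c * b ≡ c * (a - b)
    factor = solve-∀

  ≈⇒≡-< : ∀ {y z} → y ℕ.< p → z ℕ.< p → + y ≈ + z [mod p ] → y ≡ z
  ≈⇒≡-< {y} {z} y<p z<p (mod p∣y-z) =
    ℤ.+-injective (ℤ.i-j≡0⇒i≡j (+ y) (+ z) (trans (ℤ.m-n≡m⊖n y z) (ℤ.∣i∣≡0⇒i≡0 ∣y⊖z∣≡0)))
    where
    p∣∣y⊖z∣ : p ℕ.∣ ℤ.∣ y ℤ.⊖ z ∣
    p∣∣y⊖z∣ = subst (λ i → p ℕ.∣ ℤ.∣ i ∣) (ℤ.m-n≡m⊖n y z) (Signed.∣⇒∣ᵤ p∣y-z)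
    ∣y⊖z∣≡0 : ℤ.∣ y ℤ.⊖ z ∣ ≡ 0
    ∣y⊖z∣≡0 = ∣∧<⇒≡0 p∣∣y⊖z∣ (ℕ.≤-<-trans (ℤ.∣m⊝n∣≤m⊔n y z) (ℕ.⊔-pres-<m y<p z<p))

  odd-prime-∤2 : ∀ M → p ≡ suc (M ℕ.+ M) → ¬ (+ p) ∣ + 2
  odd-prime-∤2 M p≡1+2M p∣2 = 2≢1+2M M (trans (sym p≡2) p≡1+2M)
    where
    p≡2 : p ≡ 2
    p≡2 = ℕ.≤-antisym (ℕ.∣⇒≤ p∣2) (ℕ.nonTrivial⇒n>1 p {{prime⇒nonTrivial p-prime}})
    2≢1+2M : ∀ M → 2 ≢ suc (M ℕ.+ M)
    2≢1+2M zero    ()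
    2≢1+2M (suc m) 2≡3+2m = ℕ.m+1+n≢0 m (sym (ℕ.suc-injective (ℕ.suc-injective 2≡3+2m)))

-- Fermat's little theorem

*-^-pred : ∀ a n → .{{_ : ℕ.NonZero n}} → a * a ^ (n ∸ 1) ≡ a ^ n
*-^-pred a (suc n) = refl

0^n≡0 : ∀ n → .{{_ : ℕ.NonZero n}} → 0ℤ ^ n ≡ 0ℤ
0^n≡0 (suc n) = refl

module _ {p : ℕ} (p-prime : Prime p) where

  private instance _ = prime⇒nonZero p-prime

  private
    open CommutativeRing (ℤmod p) using (semiring)
    open import Algebra.Properties.Semiring.Exp semiring using () renaming (_^_ to _^ₘ_)
    open import Algebra.Properties.Semiring.Mult semiring using () renaming (_×_ to _·_)

    ^ₘ≡^ : ∀ a n → a ^ₘ n ≡ a ^ n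
    ^ₘ≡^ a zero    = refl
    ^ₘ≡^ a (suc n) = cong (a *_) (^ₘ≡^ a n)

    n·1≡+n : ∀ n → n · 1ℤ ≡ + n
    n·1≡+n zero    = refl
    n·1≡+n (suc n) = cong (_+_ 1ℤ) (n·1≡+n n)

  freshman's-dream-mod : ∀ a b → (a + b) ^ p ≈ a ^ p + b ^ p [mod p ]
  freshman's-dream-mod a b = subst₂ (_≈_[mod p ]) (^ₘ≡^ (a + b) p) (cong₂ _+_ (^ₘ≡^ a p) (^ₘ≡^ b p))
    (freshman's-dream semiring p-prime (subst (_≈ 0ℤ [mod p ]) (sym (n·1≡+n p)) modulus≈0)
      (mod-reflexive (ℤ.*-comm a b)))

  fermat : ∀ a → a ^ p ≈ a [mod p ]
  fermat a = mod-trans (^-cong-mod p (a≈a%ℕn a)) (mod-trans (fermat-ℕ (a %ℕ p)) (mod-sym (a≈a%ℕn a)))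
    where
    fermat-ℕ : ∀ n → (+ n) ^ p ≈ + n [mod p ]
    fermat-ℕ zero    = mod-reflexive (0^n≡0 p)
    fermat-ℕ (suc n) = mod-trans (freshman's-dream-mod 1ℤ (+ n))
      (+-cong-mod (mod-reflexive (ℤ.^-zeroˡ p)) (fermat-ℕ n))

  fermat-unit : ∀ a → ¬ (+ p) ∣ a → a ^ (p ∸ 1) ≈ 1ℤ [mod p ]
  fermat-unit a p∤a = *-cancelˡ-mod p-prime a p∤a
    (mod-trans (mod-reflexive (*-^-pred a p)) (mod-trans (fermat a) (mod-reflexive (sym (ℤ.*-identityʳ a)))))

-- The ring ℤ[√D] modulo n

module QuadraticIntegers (D : ℤ) where

  -- (a , b) stands for a + b√D.

  infixl 6 _⊕_
  infixl 7 _⊗_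

  _⊕_ : ℤ × ℤ → ℤ × ℤ → ℤ × ℤ
  (a , b) ⊕ (c , d) = (a + c , b + d)

  _⊗_ : ℤ × ℤ → ℤ × ℤ → ℤ × ℤ
  (a , b) ⊗ (c , d) = (a * c + D * (b * d) , a * d + b * c)

  private
    ⊕-assoc : ∀ x y z → (x ⊕ y) ⊕ z ≡ x ⊕ (y ⊕ z)
    ⊕-assoc (a , b) (c , d) (e , f) = cong₂ _,_ (ℤ.+-assoc a c e) (ℤ.+-assoc b d f)

    ⊕-identityˡ : ∀ x → (0ℤ , 0ℤ) ⊕ x ≡ x
    ⊕-identityˡ (a , b) = cong₂ _,_ (ℤ.+-identityˡ a) (ℤ.+-identityˡ b)

    ⊕-comm : ∀ x y → x ⊕ y ≡ y ⊕ x
    ⊕-comm (a , b) (c , d) = cong₂ _,_ (ℤ.+-comm a c) (ℤ.+-comm b d)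

    ⊗-assoc : ∀ x y z → (x ⊗ y) ⊗ z ≡ x ⊗ (y ⊗ z)
    ⊗-assoc (a , b) (c , d) (e , f) = cong₂ _,_ (first D a b c d e f) (second D a b c d e f)
      where
      first : ∀ D a b c d e f → (a * c + D * (b * d)) * e + D * ((a * d + b * c) * f)
                               ≡ a * (c * e + D * (d * f)) + D * (b * (c * f + d * e))
      first = solve-∀
      second : ∀ D a b c d e f → (a * c + D * (b * d)) * f + (a * d + b * c) * e
                                ≡ a * (c * f + d * e) + b * (c * e + D * (d * f))
      second = solve-∀

    ⊗-identityˡ : ∀ x → (1ℤ , 0ℤ) ⊗ x ≡ x
    ⊗-identityˡ (a , b) = cong₂ _,_ (first D a b) (second a b)
      where
      first : ∀ D a b → 1ℤ * a + D * (0ℤ * b) ≡ a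
      first = solve-∀
      second : ∀ a b → 1ℤ * b + 0ℤ * a ≡ b
      second = solve-∀

    ⊗-comm : ∀ x y → x ⊗ y ≡ y ⊗ x
    ⊗-comm (a , b) (c , d) = cong₂ _,_ (first D a b c d) (second a b c d)
      where
      first : ∀ D a b c d → a * c + D * (b * d) ≡ c * a + D * (d * b)
      first = solve-∀
      second : ∀ a b c d → a * d + b * c ≡ c * b + d * a
      second = solve-∀

    ⊗-distribʳ-⊕ : ∀ x y z → (y ⊕ z) ⊗ x ≡ y ⊗ x ⊕ z ⊗ x
    ⊗-distribʳ-⊕ (a , b) (c , d) (e , f) = cong₂ _,_ (first D a b c d e f) (second a b c d e f)
      where
      first : ∀ D a b c d e f → (c + e) * a + D * ((d + f) * b)
                               ≡ (c * a + D * (d * b)) + (e * a + D * (f * b))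
      first = solve-∀
      second : ∀ a b c d e f → (c + e) * b + (d + f) * a ≡ (c * b + d * a) + (e * b + f * a)
      second = solve-∀

    ⊗-zeroˡ : ∀ x → (0ℤ , 0ℤ) ⊗ x ≡ (0ℤ , 0ℤ)
    ⊗-zeroˡ (a , b) = cong₂ _,_ (first D a b) (second a b)
      where
      first : ∀ D a b → 0ℤ * a + D * (0ℤ * b) ≡ 0ℤ
      first = solve-∀
      second : ∀ a b → 0ℤ * b + 0ℤ * a ≡ 0ℤ
      second = solve-∀

  module _ (n : ℕ) where

    private
      infix 4 _≈_
      _≈_ : ℤ × ℤ → ℤ × ℤ → Set
      _≈_ = Pointwise _≈_[mod n ] _≈_[mod n ]

      ≈-reflexive : ∀ {x y} → x ≡ y → x ≈ y
      ≈-reflexive refl = mod-refl , mod-refl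

      ≈-isEquivalence : IsEquivalence _≈_
      ≈-isEquivalence = ×-isEquivalence mod-isEquivalence mod-isEquivalence

      ⊕-cong : ∀ {x y z w} → x ≈ y → z ≈ w → x ⊕ z ≈ y ⊕ w
      ⊕-cong (a≈b , c≈d) (e≈f , g≈h) = +-cong-mod a≈b e≈f , +-cong-mod c≈d g≈h

      ⊗-cong : ∀ {x y z w} → x ≈ y → z ≈ w → x ⊗ z ≈ y ⊗ w
      ⊗-cong (a≈b , c≈d) (e≈f , g≈h) =
        +-cong-mod (*-cong-mod a≈b e≈f) (*-cong-mod (mod-refl {a = D}) (*-cong-mod c≈d g≈h)) ,
        +-cong-mod (*-cong-mod a≈b g≈h) (*-cong-mod c≈d e≈f)

      commutativeMonoid : ∀ {_∙_} ε → (∀ {x y z w} → x ≈ y → z ≈ w → (x ∙ z) ≈ (y ∙ w)) →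
        (∀ x y z → (x ∙ y) ∙ z ≡ x ∙ (y ∙ z)) → (∀ x → ε ∙ x ≡ x) → (∀ x y → x ∙ y ≡ y ∙ x) →
        IsCommutativeMonoid _≈_ _∙_ ε
      commutativeMonoid ε cong assoc identityˡ comm = isCommutativeMonoidˡ record
        { isSemigroup = record
          { isMagma = record { isEquivalence = ≈-isEquivalence ; ∙-cong = cong }
          ; assoc = λ x y z → ≈-reflexive (assoc x y z) }
        ; identityˡ = λ x → ≈-reflexive (identityˡ x)
        ; comm = λ x y → ≈-reflexive (comm x y) }

    semiring-mod : CommutativeSemiring 0ℓ 0ℓ
    semiring-mod = record { isCommutativeSemiring = isCommutativeSemiringˡ record
      { +-isCommutativeMonoid = commutativeMonoid (0ℤ , 0ℤ) ⊕-cong ⊕-assoc ⊕-identityˡ ⊕-comm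
      ; *-isCommutativeMonoid = commutativeMonoid (1ℤ , 0ℤ) ⊗-cong ⊗-assoc ⊗-identityˡ ⊗-comm
      ; distribʳ = λ x y z → ≈-reflexive (⊗-distribʳ-⊕ x y z)
      ; zeroˡ = λ x → ≈-reflexive (⊗-zeroˡ x) } }

  module _ {p : ℕ} (p-prime : Prime p) where

    open CommutativeSemiring (semiring-mod p) using (_≈_; semiring; setoid; *-comm)
    open import Algebra.Properties.Semiring.Exp semiring using () renaming (_^_ to _^ₛ_)
    open import Algebra.Properties.Semiring.Mult semiring using () renaming (_×_ to _·_)

    private
      ^ₛ-integer : ∀ a k → (a , 0ℤ) ^ₛ k ≡ (a ^ k , 0ℤ)
      ^ₛ-integer a zero    = refl
      ^ₛ-integer a (suc k) rewrite ^ₛ-integer a k = cong₂ _,_ (first D a (a ^ k)) (second a (a ^ k))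
        where
        first : ∀ D a b → a * b + D * (0ℤ * 0ℤ) ≡ a * b
        first = solve-∀
        second : ∀ a b → a * 0ℤ + 0ℤ * b ≡ 0ℤ
        second = solve-∀

      √D-times : ∀ a b → (0ℤ , 1ℤ) ⊗ (a , b) ≡ (D * b , a)
      √D-times a b = cong₂ _,_ (first D a b) (second a b)
        where
        first : ∀ D a b → 0ℤ * a + D * (1ℤ * b) ≡ D * b
        first = solve-∀
        second : ∀ a b → 0ℤ * b + 1ℤ * a ≡ a
        second = solve-∀

      ^ₛ-√D : ∀ m → (0ℤ , 1ℤ) ^ₛ suc (m ℕ.+ m) ≡ (0ℤ , D ^ m)
      ^ₛ-√D zero    = trans (√D-times 1ℤ 0ℤ) (cong (_, 1ℤ) (ℤ.*-zeroʳ D))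
      ^ₛ-√D (suc m) = begin
        (0ℤ , 1ℤ) ^ₛ suc (suc m ℕ.+ suc m)           ≡⟨ cong (λ k → (0ℤ , 1ℤ) ^ₛ suc (suc k)) (ℕ.+-suc m m) ⟩
        √D ⊗ (√D ⊗ (0ℤ , 1ℤ) ^ₛ suc (m ℕ.+ m))      ≡⟨ cong (λ x → √D ⊗ (√D ⊗ x)) (^ₛ-√D m) ⟩
        √D ⊗ (√D ⊗ (0ℤ , D ^ m))                   ≡⟨ cong (√D ⊗_) (√D-times 0ℤ (D ^ m)) ⟩
        √D ⊗ (D * D ^ m , 0ℤ)                      ≡⟨ √D-times (D * D ^ m) 0ℤ ⟩
        (D * 0ℤ , D ^ suc m)                       ≡⟨ cong (_, D ^ suc m) (ℤ.*-zeroʳ D) ⟩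
        (0ℤ , D ^ suc m)                           ∎
        where
        open ≡-Reasoning
        √D = (0ℤ , 1ℤ)

      k·1≡+k : ∀ k → k · (1ℤ , 0ℤ) ≡ (+ k , 0ℤ)
      k·1≡+k zero    = refl
      k·1≡+k (suc k) = cong (λ x → (1ℤ , 0ℤ) ⊕ x) (k·1≡+k k)

    frobenius : ∀ B M → p ≡ suc (M ℕ.+ M) → (B , 1ℤ) ^ₛ p ≈ (B , D ^ M)
    frobenius B M p≡1+2M = begin
      (B , 1ℤ) ^ₛ p                     ≡⟨ cong (λ b → (b , 1ℤ) ^ₛ p) (ℤ.+-identityʳ B) ⟨
      ((B , 0ℤ) ⊕ (0ℤ , 1ℤ)) ^ₛ p       ≈⟨ freshman's-dream semiring p-prime p·1≈0 (*-comm (B , 0ℤ) (0ℤ , 1ℤ)) ⟩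
      (B , 0ℤ) ^ₛ p ⊕ (0ℤ , 1ℤ) ^ₛ p    ≡⟨ cong₂ _⊕_ (^ₛ-integer B p) (trans (cong ((0ℤ , 1ℤ) ^ₛ_) p≡1+2M) (^ₛ-√D M)) ⟩
      (B ^ p + 0ℤ , 0ℤ + D ^ M)         ≈⟨ mod-trans (mod-reflexive (ℤ.+-identityʳ _)) (fermat p-prime B) ,
                                           mod-reflexive (ℤ.+-identityˡ _) ⟩
      (B , D ^ M)                       ∎
      where
      open import Relation.Binary.Reasoning.Setoid setoid
      p·1≈0 : p · (1ℤ , 0ℤ) ≈ (0ℤ , 0ℤ)
      p·1≈0 = subst (_≈ (0ℤ , 0ℤ)) (sym (k·1≡+k p)) (modulus≈0 , mod-refl)

-- Products over sets of residues

module ∏ = SubsetSum ℤ.*-1-commutativeMonoid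
module # = SubsetSum ℕ.+-0-commutativeMonoid

∏ : (ℕ → Bool) → ℕ → ℤ
∏ S = ∏.∑ S (λ z → + z)

count : (ℕ → Bool) → ℕ → ℕ
count S = #.∑ S (λ _ → 1)

module _ (p : ℕ) (c : ℤ) (g : ℕ → ℕ) where

  record Paired (n : ℕ) (S : ℕ → Bool) : Set where
    field
      bounded      : ∀ z → S z ≡ true → z ℕ.< n
      closed       : ∀ z → S z ≡ true → S (g z) ≡ true
      involutive   : ∀ z → S z ≡ true → g (g z) ≡ z
      no-fixpoint  : ∀ z → S z ≡ true → g z ≢ z
      pair-product : ∀ z → S z ≡ true → + z * + g z ≈ c [mod p ]

  remove-pair : ∀ {n S} z → Paired n S → S z ≡ true → Paired n (S ∖ z ∖ g z)
  remove-pair {n} {S} z paired S∋z = record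
    { bounded      = λ w → bounded w ∘ in-S w
    ; closed       = closed′
    ; involutive   = λ w → involutive w ∘ in-S w
    ; no-fixpoint  = λ w → no-fixpoint w ∘ in-S w
    ; pair-product = λ w → pair-product w ∘ in-S w
    }
    where
    open Paired paired
    in-S : ∀ w → (S ∖ z ∖ g z) w ≡ true → S w ≡ true
    in-S w S′∋w = proj₁ (∖-member S z w (proj₁ (∖-member (S ∖ z) (g z) w S′∋w)))
    closed′ : ∀ w → (S ∖ z ∖ g z) w ≡ true → (S ∖ z ∖ g z) (g w) ≡ true
    closed′ w S′∋w with ∖-member (S ∖ z) (g z) w S′∋w
    ... | S∖z∋w , w≢gz with ∖-member S z w S∖z∋w
    ...   | S∋w , w≢z = begin
      (S ∖ z ∖ g z) (g w)  ≡⟨ ∖-other (S ∖ z) (λ gw≡gz → w≢z (g-injective gw≡gz)) ⟩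
      (S ∖ z) (g w)        ≡⟨ ∖-other S (λ gw≡z → w≢gz (trans (sym (involutive w S∋w)) (cong g gw≡z))) ⟩
      S (g w)              ≡⟨ closed w S∋w ⟩
      true                 ∎
      where
      open ≡-Reasoning
      g-injective : g w ≡ g z → w ≡ z
      g-injective gw≡gz = trans (sym (involutive w S∋w)) (trans (cong g gw≡gz) (involutive z S∋z))

  module _ {n S z} (paired : Paired n S) (z<n : z ℕ.< n) (S∋z : S z ≡ true) where

    open Paired paired

    private
      gz<n : g z ℕ.< n
      gz<n = bounded (g z) (closed z S∋z)

      S∖z∋gz : (S ∖ z) (g z) ≡ true
      S∖z∋gz = trans (∖-other S (no-fixpoint z S∋z)) (closed z S∋z)

    ∏-remove-pair : ∏ S n ≡ (+ z * + g z) * ∏ (S ∖ z ∖ g z) n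
    ∏-remove-pair = begin
      ∏ S n                              ≡⟨ ∏.∑-remove _ n z<n S∋z ⟩
      + z * ∏ (S ∖ z) n                  ≡⟨ cong (+ z *_) (∏.∑-remove _ n gz<n S∖z∋gz) ⟩
      + z * (+ g z * ∏ (S ∖ z ∖ g z) n)  ≡⟨ ℤ.*-assoc (+ z) (+ g z) _ ⟨
      (+ z * + g z) * ∏ (S ∖ z ∖ g z) n  ∎
      where open ≡-Reasoning

    count-remove-pair : count S n ≡ suc (suc (count (S ∖ z ∖ g z) n))
    count-remove-pair = begin
      count S n                          ≡⟨ #.∑-remove _ n z<n S∋z ⟩
      suc (count (S ∖ z) n)              ≡⟨ cong suc (#.∑-remove _ n gz<n S∖z∋gz) ⟩
      suc (suc (count (S ∖ z ∖ g z) n))  ∎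
      where open ≡-Reasoning

  ∏-pairing : ∀ k {n S} → Paired n S → count S n ≡ k ℕ.+ k → ∏ S n ≈ c ^ k [mod p ]
  ∏-pairing k {n} {S} paired #S≡2k with member-or-empty S n
  ∏-pairing zero    paired #S≡0 | inj₂ S-empty = mod-reflexive (∏.∑-empty _ _ S-empty)
  ∏-pairing (suc k) paired #S≡2k | inj₂ S-empty =
    ⊥-elim (ℕ.1+n≢0 (trans (sym #S≡2k) (#.∑-empty _ _ S-empty)))
  ∏-pairing zero    paired #S≡0 | inj₁ (z , z<n , S∋z) =
    ⊥-elim (ℕ.1+n≢0 (trans (sym (#.∑-remove _ _ z<n S∋z)) #S≡0))
  ∏-pairing (suc k) {n} {S} paired #S≡2k | inj₁ (z , z<n , S∋z) = begin
    ∏ S n                              ≡⟨ ∏-remove-pair paired z<n S∋z ⟩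
    (+ z * + g z) * ∏ (S ∖ z ∖ g z) n  ≈⟨ *-cong-mod (Paired.pair-product paired z S∋z)
                                            (∏-pairing k (remove-pair z paired S∋z) #S′≡2k) ⟩
    c * c ^ k                          ∎
    where
    open ModReasoning p
    #S′≡2k : count (S ∖ z ∖ g z) n ≡ k ℕ.+ k
    #S′≡2k = ℕ.suc-injective (ℕ.suc-injective
      (trans (sym (count-remove-pair paired z<n S∋z)) (trans #S≡2k (cong suc (ℕ.+-suc k k)))))

-- Wilson's theorem and Euler's criterion

^-square : ∀ x n → (x * x) ^ n ≡ x ^ (n ℕ.+ n)
^-square x zero    = refl
^-square x (suc n) = begin
  (x * x) * (x * x) ^ n       ≡⟨ cong ((x * x) *_) (^-square x n) ⟩
  (x * x) * x ^ (n ℕ.+ n)     ≡⟨ ℤ.*-assoc x x _ ⟩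
  x * x ^ suc (n ℕ.+ n)       ≡⟨ cong (λ k → x * x ^ k) (ℕ.+-suc n n) ⟨
  x ^ (suc n ℕ.+ suc n)       ∎
  where open ≡-Reasoning

^-∸2 : ∀ a n → .{{_ : ℕ.NonTrivial n}} → a * a ^ (n ∸ 2) ≡ a ^ (n ∸ 1)
^-∸2 a (suc (suc n)) = refl

module _ {p : ℕ} (p-prime : Prime p) where

  private instance
    _ = prime⇒nonZero p-prime
    _ = prime⇒nonTrivial p-prime

  units : ℕ → Bool
  units z = (0 ℕ.<ᵇ z) ∧ (z ℕ.<ᵇ p)

  units-intro : ∀ {z} → 0 ℕ.< z → z ℕ.< p → units z ≡ true
  units-intro 0<z z<p = cong₂ _∧_ (Equivalence.to T-≡ (ℕ.<⇒<ᵇ 0<z)) (Equivalence.to T-≡ (ℕ.<⇒<ᵇ z<p))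

  units-elim : ∀ z → units z ≡ true → 0 ℕ.< z × z ℕ.< p
  units-elim z units∋z with Equivalence.to T-∧ (Equivalence.from T-≡ units∋z)
  ... | 0<ᵇz , z<ᵇp = ℕ.<ᵇ⇒< 0 z 0<ᵇz , ℕ.<ᵇ⇒< z p z<ᵇp

  count-units : count units p ≡ p ∸ 1
  count-units = count-units≤ p ℕ.≤-refl
    where
    count-units≤ : ∀ n → n ℕ.≤ p → count units n ≡ n ∸ 1
    count-units≤ zero          _     = refl
    count-units≤ (suc zero)    _     = refl
    count-units≤ (suc (suc n)) 2+n≤p = trans
      (cong (λ b → if b then suc (count units (suc n)) else count units (suc n)) (units-intro ℕ.z<s 2+n≤p))
      (cong suc (count-units≤ (suc n) (ℕ.<⇒≤ 2+n≤p)))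

  unit-∤ : ∀ z → units z ≡ true → ¬ (+ p) ∣ + z
  unit-∤ z units∋z with units-elim z units∋z
  ... | 0<z , z<p = ℕ.>⇒∤ {{ℕ.>-nonZero 0<z}} z<p

  ∤⇒0< : ∀ k → ¬ (+ p) ∣ + k → 0 ℕ.< k
  ∤⇒0< zero    p∤0 = ⊥-elim (p∤0 (p ℕ.∣0))
  ∤⇒0< (suc k) _   = ℕ.z<s

  infixl 7 _÷_
  _÷_ : ℤ → ℕ → ℕ
  c ÷ z = (c * (+ z) ^ (p ∸ 2)) %ℕ p

  ÷-< : ∀ c z → c ÷ z ℕ.< p
  ÷-< c z = ℤ.n%ℕd<d (c * (+ z) ^ (p ∸ 2)) p

  *-÷ : ∀ c z → units z ≡ true → + z * + (c ÷ z) ≈ c [mod p ]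
  *-÷ c z units∋z = begin
    + z * + (c ÷ z)              ≈⟨ *-congˡ-mod (+ z) (mod-sym (a≈a%ℕn (c * (+ z) ^ (p ∸ 2)))) ⟩
    + z * (c * (+ z) ^ (p ∸ 2))    ≡⟨ reassoc (+ z) c ((+ z) ^ (p ∸ 2)) ⟩
    c * (+ z * (+ z) ^ (p ∸ 2))    ≡⟨ cong (c *_) (^-∸2 (+ z) p) ⟩
    c * (+ z) ^ (p ∸ 1)          ≈⟨ *-congˡ-mod c (fermat-unit p-prime (+ z) (unit-∤ z units∋z)) ⟩
    c * 1ℤ                       ≡⟨ ℤ.*-identityʳ c ⟩
    c                            ∎
    where
    open ModReasoning p
    reassoc : ∀ a b c → a * (b * c) ≡ b * (a * c)
    reassoc = solve-∀

  ÷-unit : ∀ c z → ¬ (+ p) ∣ c → units z ≡ true → units (c ÷ z) ≡ true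
  ÷-unit c z p∤c units∋z = units-intro (∤⇒0< (c ÷ z) p∤c÷z) (÷-< c z)
    where
    p∤c÷z : ¬ (+ p) ∣ + (c ÷ z)
    p∤c÷z p∣c÷z = p∤c (≈0⇒∣ (mod-trans (mod-sym (*-÷ c z units∋z))
      (mod-trans (*-congˡ-mod (+ z) (∣⇒≈0 (+ (c ÷ z)) p∣c÷z)) (mod-reflexive (ℤ.*-zeroʳ (+ z))))))

  ÷-involutive : ∀ c z → ¬ (+ p) ∣ c → units z ≡ true → c ÷ (c ÷ z) ≡ z
  ÷-involutive c z p∤c units∋z = ≈⇒≡-< p-prime (÷-< c (c ÷ z)) (proj₂ (units-elim z units∋z))
    (*-cancelˡ-mod p-prime (+ (c ÷ z)) (unit-∤ (c ÷ z) units∋c÷z) (begin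
      + (c ÷ z) * + (c ÷ (c ÷ z))  ≈⟨ *-÷ c (c ÷ z) units∋c÷z ⟩
      c                            ≈⟨ *-÷ c z units∋z ⟨
      + z * + (c ÷ z)              ≡⟨ ℤ.*-comm (+ z) (+ (c ÷ z)) ⟩
      + (c ÷ z) * + z              ∎))
    where
    open ModReasoning p
    units∋c÷z = ÷-unit c z p∤c units∋z

  ÷-paired : ∀ {c S} → ¬ (+ p) ∣ c →
             (∀ z → S z ≡ true → units z ≡ true) →
             (∀ z → S z ≡ true → S (c ÷ z) ≡ true) →
             (∀ z → S z ≡ true → ¬ (+ z * + z ≈ c [mod p ])) →
             Paired p c (c ÷_) p S
  ÷-paired {c} p∤c S⊆units closed no-root = record
    { bounded      = λ z → proj₂ ∘ units-elim z ∘ S⊆units z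
    ; closed       = closed
    ; involutive   = λ z → ÷-involutive c z p∤c ∘ S⊆units z
    ; no-fixpoint  = λ z S∋z c÷z≡z →
        no-root z S∋z (subst (λ w → + z * + w ≈ c [mod p ]) c÷z≡z (*-÷ c z (S⊆units z S∋z)))
    ; pair-product = λ z → *-÷ c z ∘ S⊆units z
    }

  ÷-self : ∀ c z → units z ≡ true → + z * + z ≈ c [mod p ] → c ÷ z ≡ z
  ÷-self c z units∋z z²≈c = ≈⇒≡-< p-prime (÷-< c z) (proj₂ (units-elim z units∋z))
    (*-cancelˡ-mod p-prime (+ z) (unit-∤ z units∋z) (mod-trans (*-÷ c z units∋z) (mod-sym z²≈c)))

  1<p : 1 ℕ.< p
  1<p = ℕ.nonTrivial⇒n>1 p

  p-1<p : p ∸ 1 ℕ.< p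
  p-1<p = ℕ.∸-monoʳ-< ℕ.z<s (ℕ.<⇒≤ 1<p)

  units∋1 : units 1 ≡ true
  units∋1 = units-intro ℕ.z<s 1<p

  units∋p-1 : units (p ∸ 1) ≡ true
  units∋p-1 = units-intro (ℕ.m<n⇒0<n∸m 1<p) p-1<p

  p-1≈-1 : + (p ∸ 1) ≈ -1ℤ [mod p ]
  p-1≈-1 = mod (Signed.divides 1ℤ (begin
    + (p ∸ 1) - -1ℤ  ≡⟨ cong +_ (ℕ.+-comm (p ∸ 1) 1) ⟩
    + suc (p ∸ 1)    ≡⟨ cong +_ (ℕ.m+[n∸m]≡n (ℕ.<⇒≤ 1<p)) ⟩
    + p              ≡⟨ ℤ.*-identityˡ (+ p) ⟨
    1ℤ * + p         ∎))
    where open ≡-Reasoning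

  root-of-unity : ∀ w → w ℕ.< p → + w * + w ≈ 1ℤ [mod p ] → w ≡ 1 ⊎ w ≡ p ∸ 1
  root-of-unity w w<p (mod p∣w²-1) with prime-∣-* p-prime (+ w - 1ℤ) (+ w + 1ℤ) p∣[w-1][w+1]
    where
    factor : ∀ w → w * w - 1ℤ ≡ (w - 1ℤ) * (w + 1ℤ)
    factor = solve-∀
    p∣[w-1][w+1] = Signed.∣⇒∣ᵤ (subst (+ p Signed.∣_) (factor (+ w)) p∣w²-1)
  ... | inj₁ p∣w-1 = inj₁ (≈⇒≡-< p-prime w<p 1<p (mod (Signed.∣ᵤ⇒∣ p∣w-1)))
  ... | inj₂ p∣w+1 = inj₂ (≈⇒≡-< p-prime w<p p-1<p (mod-trans w≈-1 (mod-sym p-1≈-1)))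
    where
    w≈-1 : + w ≈ -1ℤ [mod p ]
    w≈-1 = mod (Signed.∣ᵤ⇒∣ p∣w+1)

  ∏-units-nonresidue : ∀ {D} M → p ≡ suc (M ℕ.+ M) → (∀ x → ¬ (x * x ≈ D [mod p ])) →
                       ∏ units p ≈ D ^ M [mod p ]
  ∏-units-nonresidue {D} M p≡1+2M nonresidue =
    ∏-pairing p D (D ÷_) M (÷-paired p∤D (λ _ → id) (λ z → ÷-unit D z p∤D) (λ z _ → nonresidue (+ z)))
      (trans count-units (cong (_∸ 1) p≡1+2M))
    where
    p∤D : ¬ (+ p) ∣ D
    p∤D p∣D = nonresidue 0ℤ (mod-sym (∣⇒≈0 D p∣D))

  module _ (p-1≢1 : p ∸ 1 ≢ 1) where

    units≠±1 : ℕ → Bool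
    units≠±1 = units ∖ 1 ∖ (p ∸ 1)

    private
      units∖1∋p-1 : (units ∖ 1) (p ∸ 1) ≡ true
      units∖1∋p-1 = trans (∖-other units p-1≢1) units∋p-1

      units≠±1-member : ∀ w → units≠±1 w ≡ true → units w ≡ true × w ≢ 1 × w ≢ p ∸ 1
      units≠±1-member w S∋w with ∖-member (units ∖ 1) (p ∸ 1) w S∋w
      ... | units∖1∋w , w≢p-1 with ∖-member units 1 w units∖1∋w
      ...   | units∋w , w≢1 = units∋w , w≢1 , w≢p-1

    ∏-units≡[p-1]*∏-units≠±1 : ∏ units p ≡ + (p ∸ 1) * ∏ units≠±1 p
    ∏-units≡[p-1]*∏-units≠±1 = begin
      ∏ units p                   ≡⟨ ∏.∑-remove _ p 1<p units∋1 ⟩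
      1ℤ * ∏ (units ∖ 1) p        ≡⟨ ℤ.*-identityˡ _ ⟩
      ∏ (units ∖ 1) p             ≡⟨ ∏.∑-remove _ p p-1<p units∖1∋p-1 ⟩
      + (p ∸ 1) * ∏ units≠±1 p    ∎
      where open ≡-Reasoning

    count-units≡2+count-units≠±1 : count units p ≡ suc (suc (count units≠±1 p))
    count-units≡2+count-units≠±1 =
      trans (#.∑-remove _ p 1<p units∋1) (cong suc (#.∑-remove _ p p-1<p units∖1∋p-1))

    units≠±1-paired : Paired p 1ℤ (1ℤ ÷_) p units≠±1
    units≠±1-paired = ÷-paired (prime-∤1 p-prime) (λ w → proj₁ ∘ units≠±1-member w) closed no-root
      where
      1÷1≡1 : 1ℤ ÷ 1 ≡ 1
      1÷1≡1 = ÷-self 1ℤ 1 units∋1 mod-refl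
      1÷[p-1]≡p-1 : 1ℤ ÷ (p ∸ 1) ≡ p ∸ 1
      1÷[p-1]≡p-1 = ÷-self 1ℤ (p ∸ 1) units∋p-1 (*-cong-mod p-1≈-1 p-1≈-1)
      closed : ∀ w → units≠±1 w ≡ true → units≠±1 (1ℤ ÷ w) ≡ true
      closed w S∋w with units≠±1-member w S∋w
      ... | units∋w , w≢1 , w≢p-1 =
        trans (∖-other (units ∖ 1) (w≢p-1 ∘ ÷-cancel (p ∸ 1) 1÷[p-1]≡p-1))
          (trans (∖-other units (w≢1 ∘ ÷-cancel 1 1÷1≡1)) (÷-unit 1ℤ w (prime-∤1 p-prime) units∋w))
        where
        ÷-cancel : ∀ v → 1ℤ ÷ v ≡ v → 1ℤ ÷ w ≡ v → w ≡ v
        ÷-cancel v 1÷v≡v 1÷w≡v =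
          trans (sym (÷-involutive 1ℤ w (prime-∤1 p-prime) units∋w)) (trans (cong (1ℤ ÷_) 1÷w≡v) 1÷v≡v)
      no-root : ∀ w → units≠±1 w ≡ true → ¬ (+ w * + w ≈ 1ℤ [mod p ])
      no-root w S∋w w²≈1 with units≠±1-member w S∋w
      ... | units∋w , w≢1 , w≢p-1 with root-of-unity w (proj₂ (units-elim w units∋w)) w²≈1
      ...   | inj₁ w≡1   = w≢1 w≡1
      ...   | inj₂ w≡p-1 = w≢p-1 w≡p-1

  wilson : ∀ M → p ≡ suc (M ℕ.+ M) → ∏ units p ≈ -1ℤ [mod p ]
  wilson zero    p≡1    = ⊥-elim (ℕ.nonTrivial⇒≢1 p≡1)
  wilson (suc m) p≡1+2M = begin
    ∏ units p                           ≡⟨ ∏-units≡[p-1]*∏-units≠±1 p-1≢1 ⟩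
    + (p ∸ 1) * ∏ (units≠±1 p-1≢1) p    ≈⟨ *-cong-mod p-1≈-1
                                             (∏-pairing p 1ℤ (1ℤ ÷_) m (units≠±1-paired p-1≢1) #≡2m) ⟩
    -1ℤ * 1ℤ ^ m                        ≡⟨ cong (-1ℤ *_) (ℤ.^-zeroˡ m) ⟩
    -1ℤ                                 ∎
    where
    open ModReasoning p
    p-1≡2+2m : p ∸ 1 ≡ suc (suc (m ℕ.+ m))
    p-1≡2+2m = trans (cong (_∸ 1) p≡1+2M) (cong suc (ℕ.+-suc m m))
    p-1≢1 : p ∸ 1 ≢ 1
    p-1≢1 p-1≡1 = ℕ.1+n≢0 (ℕ.suc-injective (trans (sym p-1≡2+2m) p-1≡1))
    #≡2m : count (units≠±1 p-1≢1) p ≡ m ℕ.+ m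
    #≡2m = ℕ.suc-injective (ℕ.suc-injective
      (trans (sym (count-units≡2+count-units≠±1 p-1≢1)) (trans count-units p-1≡2+2m)))

  euler-criterion : ∀ {D} M → p ≡ suc (M ℕ.+ M) → (∀ x → ¬ (x * x ≈ D [mod p ])) → D ^ M ≈ -1ℤ [mod p ]
  euler-criterion M p≡1+2M nonresidue =
    mod-trans (mod-sym (∏-units-nonresidue M p≡1+2M nonresidue)) (wilson M p≡1+2M)

  euler-criterion-residue : ∀ {D} x M → p ≡ suc (M ℕ.+ M) → ¬ (+ p) ∣ D → x * x ≈ D [mod p ] →
                            D ^ M ≈ 1ℤ [mod p ]
  euler-criterion-residue {D} x M p≡1+2M p∤D x²≈D = begin
    D ^ M             ≈⟨ ^-cong-mod M x²≈D ⟨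
    (x * x) ^ M       ≡⟨ ^-square x M ⟩
    x ^ (M ℕ.+ M)     ≡⟨ cong (λ k → x ^ (k ∸ 1)) p≡1+2M ⟨
    x ^ (p ∸ 1)       ≈⟨ fermat-unit p-prime x p∤x ⟩
    1ℤ                ∎
    where
    open ModReasoning p
    p∤x : ¬ (+ p) ∣ x
    p∤x p∣x = p∤D (≈0⇒∣ (mod-trans (mod-sym x²≈D) (*-congʳ-mod x (∣⇒≈0 x p∣x))))

-- Lucas sequences

module Lucas (A B : ℤ) where

  D = B * B - + 4 * A
  u = lucasU A B
  v = lucasV A B

  private
    double-step : ∀ A B x y → + 2 * (B * x - A * y) ≡ B * (+ 2 * x) - A * (+ 2 * y)
    double-step = solve-∀

  2u[n+1]≡v[n]+Bu[n] : ∀ n → + 2 * u (suc n) ≡ v n + B * u n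
  2u[n+1]≡v[n]+Bu[n] zero          = base B
    where
    base : ∀ B → + 2 * + 1 ≡ + 2 + B * + 0
    base = solve-∀
  2u[n+1]≡v[n]+Bu[n] (suc zero)    = base A B
    where
    base : ∀ A B → + 2 * (B * + 1 - A * + 0) ≡ B + B * + 1
    base = solve-∀
  2u[n+1]≡v[n]+Bu[n] (suc (suc n)) = begin
    + 2 * u (3 ℕ.+ n)
      ≡⟨ double-step A B (u (2 ℕ.+ n)) (u (suc n)) ⟩
    B * (+ 2 * u (2 ℕ.+ n)) - A * (+ 2 * u (suc n))
      ≡⟨ cong₂ (λ x y → B * x - A * y) (2u[n+1]≡v[n]+Bu[n] (suc n)) (2u[n+1]≡v[n]+Bu[n] n) ⟩
    B * (v (suc n) + B * u (suc n)) - A * (v n + B * u n)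
      ≡⟨ regroup A B (v (suc n)) (v n) (u (suc n)) (u n) ⟩
    v (2 ℕ.+ n) + B * u (2 ℕ.+ n)
      ∎
    where
    open ≡-Reasoning
    regroup : ∀ A B a b c d → B * (a + B * c) - A * (b + B * d) ≡ (B * a - A * b) + B * (B * c - A * d)
    regroup = solve-∀

  2v[n+1]≡Bv[n]+Du[n] : ∀ n → + 2 * v (suc n) ≡ B * v n + D * u n
  2v[n+1]≡Bv[n]+Du[n] zero          = base A B
    where
    base : ∀ A B → + 2 * B ≡ B * + 2 + (B * B - + 4 * A) * + 0
    base = solve-∀
  2v[n+1]≡Bv[n]+Du[n] (suc zero)    = base A B
    where
    base : ∀ A B → + 2 * (B * B - A * + 2) ≡ B * B + (B * B - + 4 * A) * + 1
    base = solve-∀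
  2v[n+1]≡Bv[n]+Du[n] (suc (suc n)) = begin
    + 2 * v (3 ℕ.+ n)
      ≡⟨ double-step A B (v (2 ℕ.+ n)) (v (suc n)) ⟩
    B * (+ 2 * v (2 ℕ.+ n)) - A * (+ 2 * v (suc n))
      ≡⟨ cong₂ (λ x y → B * x - A * y) (2v[n+1]≡Bv[n]+Du[n] (suc n)) (2v[n+1]≡Bv[n]+Du[n] n) ⟩
    B * (B * v (suc n) + D * u (suc n)) - A * (B * v n + D * u n)
      ≡⟨ regroup A B D (v (suc n)) (v n) (u (suc n)) (u n) ⟩
    B * v (2 ℕ.+ n) + D * u (2 ℕ.+ n)
      ∎
    where
    open ≡-Reasoning
    regroup : ∀ A B D a b c d →
      B * (B * a + D * c) - A * (B * b + D * d) ≡ B * (B * a - A * b) + D * (B * c - A * d)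
    regroup = solve-∀

  v²-Du²≡4Aⁿ : ∀ n → v n * v n - D * (u n * u n) ≡ + 4 * A ^ n
  v²-Du²≡4Aⁿ zero    = base A B
    where
    base : ∀ A B → + 2 * + 2 - (B * B - + 4 * A) * (+ 0 * + 0) ≡ + 4 * 1ℤ
    base = solve-∀
  v²-Du²≡4Aⁿ (suc n) = ℤ.*-cancelˡ-≡ (+ 4) _ _ (begin
    + 4 * (v (suc n) * v (suc n) - D * (u (suc n) * u (suc n)))  ≡⟨ scale D (v (suc n)) (u (suc n)) ⟩
    (+ 2 * v (suc n)) * (+ 2 * v (suc n)) - D * ((+ 2 * u (suc n)) * (+ 2 * u (suc n)))
      ≡⟨ cong₂ (λ x y → x * x - D * (y * y)) (2v[n+1]≡Bv[n]+Du[n] n) (2u[n+1]≡v[n]+Bu[n] n) ⟩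
    (B * v n + D * u n) * (B * v n + D * u n) - D * ((v n + B * u n) * (v n + B * u n))
      ≡⟨ multiplicative A B (v n) (u n) ⟩
    + 4 * (A * (v n * v n - D * (u n * u n)))                    ≡⟨ cong (λ x → + 4 * (A * x)) (v²-Du²≡4Aⁿ n) ⟩
    + 4 * (A * (+ 4 * A ^ n))                                    ≡⟨ cong (+ 4 *_) (swap A (A ^ n)) ⟩
    + 4 * (+ 4 * A ^ suc n)                                      ∎)
    where
    open ≡-Reasoning
    scale : ∀ D x y → + 4 * (x * x - D * (y * y)) ≡ (+ 2 * x) * (+ 2 * x) - D * ((+ 2 * y) * (+ 2 * y))
    scale = solve-∀
    multiplicative : ∀ A B x y →
      (B * x + (B * B - + 4 * A) * y) * (B * x + (B * B - + 4 * A) * y)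
        - (B * B - + 4 * A) * ((x + B * y) * (x + B * y))
      ≡ + 4 * (A * (x * x - (B * B - + 4 * A) * (y * y)))
    multiplicative = solve-∀
    swap : ∀ a b → a * (+ 4 * b) ≡ + 4 * (a * b)
    swap = solve-∀

  4Av[n]≡2Bv[n+1]-2Du[n+1] : ∀ n → + 4 * A * v n ≡ B * (+ 2 * v (suc n)) - D * (+ 2 * u (suc n))
  4Av[n]≡2Bv[n+1]-2Du[n+1] n = begin
    + 4 * A * v n
      ≡⟨ eliminate A B (v n) (u n) ⟩
    B * (B * v n + D * u n) - D * (v n + B * u n)
      ≡⟨ cong₂ (λ x y → B * x - D * y) (2v[n+1]≡Bv[n]+Du[n] n) (2u[n+1]≡v[n]+Bu[n] n) ⟨
    B * (+ 2 * v (suc n)) - D * (+ 2 * u (suc n))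
      ∎
    where
    open ≡-Reasoning
    eliminate : ∀ A B x y →
      + 4 * A * x ≡ B * (B * x + (B * B - + 4 * A) * y) - (B * B - + 4 * A) * (x + B * y)
    eliminate = solve-∀

  4Au[n]≡2Bu[n+1]-2v[n+1] : ∀ n → + 4 * A * u n ≡ B * (+ 2 * u (suc n)) - + 2 * v (suc n)
  4Au[n]≡2Bu[n+1]-2v[n+1] n = begin
    + 4 * A * u n
      ≡⟨ eliminate A B (v n) (u n) ⟩
    B * (v n + B * u n) - (B * v n + D * u n)
      ≡⟨ cong₂ (λ x y → B * x - y) (2u[n+1]≡v[n]+Bu[n] n) (2v[n+1]≡Bv[n]+Du[n] n) ⟨
    B * (+ 2 * u (suc n)) - + 2 * v (suc n)
      ∎
    where
    open ≡-Reasoning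
    eliminate : ∀ A B x y → + 4 * A * y ≡ B * (x + B * y) - (B * x + (B * B - + 4 * A) * y)
    eliminate = solve-∀

  module _ {p : ℕ} (p-prime : Prime p) where

    open QuadraticIntegers D
    open CommutativeSemiring (semiring-mod p) using (semiring)
    open import Algebra.Properties.Semiring.Exp semiring using () renaming (_^_ to _^ₛ_)

    private
      2[B+√D]ⁿ : ∀ n → + 2 * proj₁ ((B , 1ℤ) ^ₛ n) ≡ (+ 2) ^ n * v n
                     × + 2 * proj₂ ((B , 1ℤ) ^ₛ n) ≡ (+ 2) ^ n * u n
      2[B+√D]ⁿ zero    = refl , refl
      2[B+√D]ⁿ (suc n) = first , second
        where
        open ≡-Reasoning
        x = proj₁ ((B , 1ℤ) ^ₛ n)
        y = proj₂ ((B , 1ℤ) ^ₛ n)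
        k = (+ 2) ^ n
        2x≡kv = proj₁ (2[B+√D]ⁿ n)
        2y≡ku = proj₂ (2[B+√D]ⁿ n)
        first : + 2 * (B * x + D * (1ℤ * y)) ≡ (+ 2 * k) * v (suc n)
        first = begin
          + 2 * (B * x + D * (1ℤ * y))  ≡⟨ spread B D x y ⟩
          B * (+ 2 * x) + D * (+ 2 * y) ≡⟨ cong₂ (λ a b → B * a + D * b) 2x≡kv 2y≡ku ⟩
          B * (k * v n) + D * (k * u n) ≡⟨ gather B D k (v n) (u n) ⟩
          k * (B * v n + D * u n)       ≡⟨ cong (k *_) (2v[n+1]≡Bv[n]+Du[n] n) ⟨
          k * (+ 2 * v (suc n))         ≡⟨ ℤ.*-assoc k (+ 2) _ ⟨
          k * + 2 * v (suc n)           ≡⟨ cong (_* v (suc n)) (ℤ.*-comm k (+ 2)) ⟩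
          (+ 2 * k) * v (suc n)         ∎
          where
          spread : ∀ B D x y → + 2 * (B * x + D * (1ℤ * y)) ≡ B * (+ 2 * x) + D * (+ 2 * y)
          spread = solve-∀
          gather : ∀ B D k a b → B * (k * a) + D * (k * b) ≡ k * (B * a + D * b)
          gather = solve-∀
        second : + 2 * (B * y + 1ℤ * x) ≡ (+ 2 * k) * u (suc n)
        second = begin
          + 2 * (B * y + 1ℤ * x)        ≡⟨ spread B x y ⟩
          + 2 * x + B * (+ 2 * y)       ≡⟨ cong₂ (λ a b → a + B * b) 2x≡kv 2y≡ku ⟩
          k * v n + B * (k * u n)       ≡⟨ gather B k (v n) (u n) ⟩
          k * (v n + B * u n)           ≡⟨ cong (k *_) (2u[n+1]≡v[n]+Bu[n] n) ⟨
          k * (+ 2 * u (suc n))         ≡⟨ ℤ.*-assoc k (+ 2) _ ⟨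
          k * + 2 * u (suc n)           ≡⟨ cong (_* u (suc n)) (ℤ.*-comm k (+ 2)) ⟩
          (+ 2 * k) * u (suc n)         ∎
          where
          spread : ∀ B x y → + 2 * (B * y + 1ℤ * x) ≡ + 2 * x + B * (+ 2 * y)
          spread = solve-∀
          gather : ∀ B k a b → k * a + B * (k * b) ≡ k * (a + B * b)
          gather = solve-∀

    lucas-frobenius : ∀ M → p ≡ suc (M ℕ.+ M) → v p ≈ B [mod p ] × u p ≈ D ^ M [mod p ]
    lucas-frobenius M p≡1+2M =
      halve (proj₁ (2[B+√D]ⁿ p)) (proj₁ [B+√D]ᵖ≈B+Dᴹ√D) , halve (proj₂ (2[B+√D]ⁿ p)) (proj₂ [B+√D]ᵖ≈B+Dᴹ√D)
      where
      [B+√D]ᵖ≈B+Dᴹ√D = frobenius p-prime B M p≡1+2M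
      halve : ∀ {x w c} → + 2 * x ≡ (+ 2) ^ p * w → x ≈ c [mod p ] → w ≈ c [mod p ]
      halve {x} {w} {c} 2x≡2ᵖw x≈c = *-cancelˡ-mod p-prime (+ 2) (odd-prime-∤2 p-prime M p≡1+2M) (begin
        + 2 * w        ≈⟨ *-congʳ-mod w (fermat p-prime (+ 2)) ⟨
        (+ 2) ^ p * w  ≡⟨ 2x≡2ᵖw ⟨
        + 2 * x        ≈⟨ *-congˡ-mod (+ 2) x≈c ⟩
        + 2 * c        ∎)
        where open ModReasoning p

    module _ (M : ℕ) (p≡1+2M : p ≡ suc (M ℕ.+ M)) (p∤A : ¬ (+ p) ∣ A) where

      private
        open ModReasoning p
        p∤2 = odd-prime-∤2 p-prime M p≡1+2M
        p∤4A : ¬ (+ p) ∣ + 4 * A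
        p∤4A = prime-∤-* p-prime (+ 4) A (prime-∤-* p-prime (+ 2) (+ 2) p∤2 p∤2) p∤A
        v[p]≈B = proj₁ (lucas-frobenius M p≡1+2M)
        u[p]≈Dᴹ = proj₂ (lucas-frobenius M p≡1+2M)

      residue-case : D ^ M ≈ 1ℤ [mod p ] → v (p ∸ 1) ≈ + 2 [mod p ] × u (p ∸ 1) ≈ 0ℤ [mod p ]
      residue-case Dᴹ≈1 = v[p-1]≈2 , u[p-1]≈0
        where
        p≡1+[p-1] : p ≡ suc (p ∸ 1)
        p≡1+[p-1] = sym (ℕ.m+[n∸m]≡n (ℕ.<⇒≤ (1<p p-prime)))
        v′≈B : v (suc (p ∸ 1)) ≈ B [mod p ]
        v′≈B = subst (λ k → v k ≈ B [mod p ]) p≡1+[p-1] v[p]≈B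
        u′≈1 : u (suc (p ∸ 1)) ≈ 1ℤ [mod p ]
        u′≈1 = subst (λ k → u k ≈ 1ℤ [mod p ]) p≡1+[p-1] (mod-trans u[p]≈Dᴹ Dᴹ≈1)
        v[p-1]≈2 = *-cancelˡ-mod p-prime (+ 4 * A) p∤4A (begin
          + 4 * A * v (p ∸ 1)
            ≡⟨ 4Av[n]≡2Bv[n+1]-2Du[n+1] (p ∸ 1) ⟩
          B * (+ 2 * v (suc (p ∸ 1))) - D * (+ 2 * u (suc (p ∸ 1)))
            ≈⟨ minus-cong-mod (*-congˡ-mod B (*-congˡ-mod (+ 2) v′≈B)) (*-congˡ-mod D (*-congˡ-mod (+ 2) u′≈1)) ⟩
          B * (+ 2 * B) - D * (+ 2 * 1ℤ)
            ≡⟨ simplify A B ⟩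
          + 4 * A * + 2
            ∎)
          where
          simplify : ∀ A B → B * (+ 2 * B) - (B * B - + 4 * A) * (+ 2 * 1ℤ) ≡ + 4 * A * + 2
          simplify = solve-∀
        u[p-1]≈0 = *-cancelˡ-mod p-prime (+ 4 * A) p∤4A (begin
          + 4 * A * u (p ∸ 1)
            ≡⟨ 4Au[n]≡2Bu[n+1]-2v[n+1] (p ∸ 1) ⟩
          B * (+ 2 * u (suc (p ∸ 1))) - + 2 * v (suc (p ∸ 1))
            ≈⟨ minus-cong-mod (*-congˡ-mod B (*-congˡ-mod (+ 2) u′≈1)) (*-congˡ-mod (+ 2) v′≈B) ⟩
          B * (+ 2 * 1ℤ) - + 2 * B
            ≡⟨ simplify A B ⟩
          + 4 * A * 0ℤ
            ∎)
          where
          simplify : ∀ A B → B * (+ 2 * 1ℤ) - + 2 * B ≡ + 4 * A * 0ℤ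
          simplify = solve-∀

      nonresidue-case : D ^ M ≈ -1ℤ [mod p ] → v (suc p) ≈ + 2 * A [mod p ] × u (suc p) ≈ 0ℤ [mod p ]
      nonresidue-case Dᴹ≈-1 = v[p+1]≈2A , u[p+1]≈0
        where
        u[p]≈-1 = mod-trans u[p]≈Dᴹ Dᴹ≈-1
        v[p+1]≈2A = *-cancelˡ-mod p-prime (+ 2) p∤2 (begin
          + 2 * v (suc p)       ≡⟨ 2v[n+1]≡Bv[n]+Du[n] p ⟩
          B * v p + D * u p     ≈⟨ +-cong-mod (*-congˡ-mod B v[p]≈B) (*-congˡ-mod D u[p]≈-1) ⟩
          B * B + D * -1ℤ       ≡⟨ simplify A B ⟩
          + 2 * (+ 2 * A)       ∎)
          where
          simplify : ∀ A B → B * B + (B * B - + 4 * A) * -1ℤ ≡ + 2 * (+ 2 * A)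
          simplify = solve-∀
        u[p+1]≈0 = *-cancelˡ-mod p-prime (+ 2) p∤2 (begin
          + 2 * u (suc p)       ≡⟨ 2u[n+1]≡v[n]+Bu[n] p ⟩
          v p + B * u p         ≈⟨ +-cong-mod v[p]≈B (*-congˡ-mod B u[p]≈-1) ⟩
          B + B * -1ℤ           ≡⟨ simplify B ⟩
          + 2 * 0ℤ              ∎)
          where
          simplify : ∀ B → B + B * -1ℤ ≡ + 2 * 0ℤ
          simplify = solve-∀

-- Dividing the norm identity by p

norm-expansion : ∀ P D a X Y t →
  (+ 2 * a + X * P) * (+ 2 * a + X * P) - D * ((t * P) * (t * P)) ≡ + 4 * (a * a * (1ℤ + Y * P)) →
  P * (+ 4 * a * (X - a * Y)) ≡ P * (P * (D * (t * t) - X * X))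
norm-expansion P D a X Y t norm = ℤ.i-j≡0⇒i≡j _ _ (begin
  P * (+ 4 * a * (X - a * Y)) - P * (P * (D * (t * t) - X * X))  ≡⟨ expand P D a X Y t ⟩
  N - + 4 * (a * a * (1ℤ + Y * P))                                ≡⟨ cong (_- + 4 * (a * a * (1ℤ + Y * P))) norm ⟩
  + 4 * (a * a * (1ℤ + Y * P)) - + 4 * (a * a * (1ℤ + Y * P))    ≡⟨ ℤ.+-inverseʳ (+ 4 * (a * a * (1ℤ + Y * P))) ⟩
  0ℤ                                                              ∎)
  where
  open ≡-Reasoning
  N = (+ 2 * a + X * P) * (+ 2 * a + X * P) - D * ((t * P) * (t * P))
  expand : ∀ P D a X Y t →
    P * (+ 4 * a * (X - a * Y)) - P * (P * (D * (t * t) - X * X))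
      ≡ ((+ 2 * a + X * P) * (+ 2 * a + X * P) - D * ((t * P) * (t * P))) - + 4 * (a * a * (1ℤ + Y * P))
  expand = solve-∀

module _ {p : ℕ} (p-prime : Prime p) where

  private instance _ = prime⇒nonZero p-prime

  norm-quotient : ∀ {D a V U K} → ¬ (+ p) ∣ + 2 → ¬ (+ p) ∣ a →
                  V ≈ + 2 * a [mod p ] → U ≈ 0ℤ [mod p ] → K ≈ 1ℤ [mod p ] →
                  V * V - D * (U * U) ≡ + 4 * (a * a * K) →
                  (V - + 2 * a) /ℕ p ≈ a * ((K - 1ℤ) /ℕ p) [mod p ]
  norm-quotient {D} {a} {V} {U} {K} p∤2 p∤a V≈2a U≈0 K≈1 norm =
    mod (Signed.∣ᵤ⇒∣ (prime-∣-*-∤ p-prime (+ 4 * a) (X - a * Y) p∤4a p∣4a[X-aY]))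
    where
    P = + p
    X = (V - + 2 * a) /ℕ p
    Y = (K - 1ℤ) /ℕ p
    t = U /ℕ p
    p∤4a : ¬ (+ p) ∣ + 4 * a
    p∤4a = prime-∤-* p-prime (+ 4) a (prime-∤-* p-prime (+ 2) (+ 2) p∤2 p∤2) p∤a
    move : ∀ {x y z} → x - y ≡ z → x ≡ y + z
    move {x} {y} refl = shuffle x y
      where
      shuffle : ∀ x y → x ≡ y + (x - y)
      shuffle = solve-∀
    V≡2a+XP : V ≡ + 2 * a + X * P
    V≡2a+XP = move (/ℕ-exact (≈⇒-≈0 V≈2a))
    K≡1+YP : K ≡ 1ℤ + Y * P
    K≡1+YP = move (/ℕ-exact (≈⇒-≈0 K≈1))
    U≡tP : U ≡ t * P
    U≡tP = /ℕ-exact U≈0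
    norm′ : (+ 2 * a + X * P) * (+ 2 * a + X * P) - D * ((t * P) * (t * P)) ≡ + 4 * (a * a * (1ℤ + Y * P))
    norm′ = subst₂ (λ v k → v * v - D * ((t * P) * (t * P)) ≡ + 4 * (a * a * k)) V≡2a+XP K≡1+YP
      (subst (λ w → V * V - D * (w * w) ≡ + 4 * (a * a * K)) U≡tP norm)
    p∣4a[X-aY] : (+ p) ∣ + 4 * a * (X - a * Y)
    p∣4a[X-aY] = Signed.∣⇒∣ᵤ (Signed.divides (D * (t * t) - X * X)
      (trans (ℤ.*-cancelˡ-≡ P _ _ (norm-expansion P D a X Y t norm′)) (ℤ.*-comm P _)))

lemma2p7 : (A B : ℤ) (p : ℕ) → .{{_ : ℕ.NonZero p}} → Prime p → p ≢ 2 →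
    ¬ ((+ p) ∣ ((B * B - + 4 * A) * A)) →
    (LegendreOne (B * B - + 4 * A) p →
    (((lucasV A B (p ∸ 1) - + 2) /ℕ p) ≡ fermatQuotient p A [mod p ]))
    × (LegendreMinusOne (B * B - + 4 * A) p →
    (((lucasV A B (suc p) - + 2 * A) /ℕ p) ≡ A * fermatQuotient p A [mod p ]))
lemma2p7 A B p p-prime p≢2 p∤DA = residue , nonresidue
  where
  open Lucas A B
  M = proj₁ (odd-prime p-prime p≢2)
  p≡1+2M = proj₂ (odd-prime p-prime p≢2)
  p∤2 = odd-prime-∤2 p-prime M p≡1+2M
  p∤D = proj₁ (∤-*⇒∤ D A p∤DA)
  p∤A = proj₂ (∤-*⇒∤ D A p∤DA)
  Aᵖ⁻¹≈1 = fermat-unit p-prime A p∤A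

  residue : LegendreOne D p → ((v (p ∸ 1) - + 2) /ℕ p) ≡ fermatQuotient p A [mod p ]
  residue (_ , x , x²≡D) = ≈⇒≡[mod] (mod-trans
    (norm-quotient p-prime {D} {1ℤ} p∤2 (prime-∤1 p-prime)
      v≈2 u≈0 Aᵖ⁻¹≈1 (trans (v²-Du²≡4Aⁿ (p ∸ 1)) (cong (+ 4 *_) (sym (ℤ.*-identityˡ _)))))
    (mod-reflexive (ℤ.*-identityˡ _)))
    where
    Dᴹ≈1 = euler-criterion-residue p-prime x M p≡1+2M p∤D (≡[mod]⇒≈ x²≡D)
    v≈2 = proj₁ (residue-case p-prime M p≡1+2M p∤A Dᴹ≈1)
    u≈0 = proj₂ (residue-case p-prime M p≡1+2M p∤A Dᴹ≈1)

  nonresidue : LegendreMinusOne D p → ((v (suc p) - + 2 * A) /ℕ p) ≡ A * fermatQuotient p A [mod p ]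
  nonresidue no-root = ≈⇒≡[mod]
    (norm-quotient p-prime {D} p∤2 p∤A v≈2A u≈0 Aᵖ⁻¹≈1 (trans (v²-Du²≡4Aⁿ (suc p)) (cong (+ 4 *_) Aᵖ⁺¹≡A²Aᵖ⁻¹)))
    where
    Dᴹ≈-1 = euler-criterion p-prime M p≡1+2M (λ x x²≈D → no-root (x , ≈⇒≡[mod] x²≈D))
    v≈2A = proj₁ (nonresidue-case p-prime M p≡1+2M p∤A Dᴹ≈-1)
    u≈0 = proj₂ (nonresidue-case p-prime M p≡1+2M p∤A Dᴹ≈-1)
    Aᵖ⁺¹≡A²Aᵖ⁻¹ : A ^ suc p ≡ A * A * A ^ (p ∸ 1)
    Aᵖ⁺¹≡A²Aᵖ⁻¹ = trans (cong (A *_) (sym (*-^-pred A p))) (sym (ℤ.*-assoc A A _))
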